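{- Let $G=(V,E)$ be a graph with positive integer edge weights $w$, and let $T=\{t_1,\dots,t_p\}\subseteq V$ be a set of terminals such that for each $1\le i\le p$ the singleton $\{t_i\}$ is the maximum volume minimum $(t_i, T\setminus\{t_i\})$-cut in $G$. Let $e=uv\in E$. If the size of a minimum isolating cut for some terminal $t_i$ in $G-e$ is smaller than in $G$, then every minimum isolating cut for $t_i$ in $G-e$ contains $u$ or $v$, and the size of the minimum isolating cut for $t_i$ decreases by at most $w(e)$; moreover, this decrease equals $w(e)$ if and only if $t_i\in\{u,v\}$. Furthermore, there are at most two terminals whose minimum isolating cut size in $G-e$ is smaller than in $G$.
   Context: $G$ is a simple undirected graph with edge weights $w(e)\in\mathbb{Z}_{>0}$. For $X,Y\subseteq V$, $w(X,Y)$ is the total weight of edges with one end in $X$ and the other in $Y$; for $X\subseteq V$, the cut $X$ has size $d(X)=w(X,V\setminus X)$. For disjoint nonempty $S,T'\subseteq V$, an $(S,T')$-cut is a set $X$ with $S\subseteq X\subseteq V\setminus T'$; a minimum $(S,T')$-cut is one of minimum size. There is a unique minimum $(S,T')$-cut containing all other minimum $(S,T')$-cuts, called the maximum volume minimum $(S,T')$-cut. An isolating cut for terminal $t_i$ is a $(\{t_i\},T\setminus\{t_i\})$-cut, and a minimum isolating cut for $t_i$ is a minimum such cut. $G-e$ denotes $G$ with edge $e$ deleted (with the same terminal set and weights on remaining edges). -}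

module Defs where

open import Data.Nat using (ℕ; zero; suc; _+_; _≤_; _<_)
open import Data.Fin using (Fin)
open import Data.Fin.Properties using (_≟_)
open import Data.Bool using (Bool; true; false; _∧_; not; if_then_else_)
open import Data.List using (List; map; allFin)
open import Data.Nat.ListAction using (sum)
open import Data.Product using (Σ; _×_; _,_; ∃)
open import Data.Sum using (_⊎_)
open import Relation.Binary.PropositionalEquality using (_≡_)
open import Relation.Nullary using (¬_; does)

-- Vertex set V = Fin n.  A weighted simple graph is given by a weight
-- function w : V → V → ℕ; w i j = 0 means "no edge ij", w i j > 0 is the
-- (positive integer) weight of edge ij.
Weights : ℕ → Set
Weights n = Fin n → Fin n → ℕ

IsSimpleGraph : ∀ {n} → Weights n → Set
IsSimpleGraph {n} w = (∀ (i j : Fin n) → w i j ≡ w j i) × (∀ (i : Fin n) → w i i ≡ 0)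

VSet : ℕ → Set
VSet n = Fin n → Bool

_⊆_ : ∀ {n} → VSet n → VSet n → Set
X ⊆ Y = ∀ i → X i ≡ true → Y i ≡ true

⟦_⟧ : ∀ {n} → Fin n → VSet n
⟦ t ⟧ i = does (i ≟ t)

_∖_ : ∀ {n} → VSet n → Fin n → VSet n
(T ∖ t) i = T i ∧ not (does (i ≟ t))

Σv : ∀ {n} → (Fin n → ℕ) → ℕ
Σv {n} f = sum (map f (allFin n))

-- d(X) = w(X, V ∖ X): total weight of ordered pairs (i,j), i ∈ X, j ∉ X
-- (each undirected edge counted once since exactly one orientation leaves X).
d : ∀ {n} → Weights n → VSet n → ℕ
d w X = Σv (λ i → Σv (λ j → if X i ∧ not (X j) then w i j else 0))

IsCut : ∀ {n} → VSet n → VSet n → VSet n → Set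
IsCut S T' X = S ⊆ X × (∀ i → T' i ≡ true → X i ≡ false)

IsMinCut : ∀ {n} → Weights n → VSet n → VSet n → VSet n → Set
IsMinCut w S T' X = IsCut S T' X × (∀ Y → IsCut S T' Y → d w X ≤ d w Y)

IsMaxVolMinCut : ∀ {n} → Weights n → VSet n → VSet n → VSet n → Set
IsMaxVolMinCut w S T' X = IsMinCut w S T' X × (∀ Y → IsMinCut w S T' Y → Y ⊆ X)

IsMinIsoCut : ∀ {n} → Weights n → VSet n → Fin n → VSet n → Set
IsMinIsoCut w T t X = IsMinCut w ⟦ t ⟧ (T ∖ t) X

deleteEdge : ∀ {n} → Weights n → Fin n → Fin n → Weights n
deleteEdge w u v i j =
  if (does (i ≟ u) ∧ does (j ≟ v)) then 0
  else if (does (i ≟ v) ∧ does (j ≟ u)) then 0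
  else w i j

Decreases : ∀ {n} → Weights n → Weights n → VSet n → Fin n → Set
Decreases w w' T t =
  Σ _ λ X → Σ _ λ Y → IsMinIsoCut w' T t X × IsMinIsoCut w T t Y × (d w' X < d w Y)

-- Deleting e = uv lowers d(X) by w(e) if X separates u and v, and not at all otherwise.
-- Hence, if the isolating cut value of t drops, every minimum isolating cut of t in G − e
-- separates u and v, the drop is at most w(e), and a drop of exactly w(e) makes such a cut
-- minimum in G as well, so it lies inside the maximum volume minimum cut {t}, forcing t ∈ {u, v}.
-- Among three decreasing terminals, two have minimum isolating cuts A, B in G − e that agree
-- on u, hence on v; by posimodularity of d, A ∖ B is again a minimum isolating cut, yet it
-- contains neither u nor v.

module Submission where

open import Defs
open import Data.Nat using (ℕ; zero; suc; _+_; _*_; _≤_; _<_; z≤n)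
open import Data.Nat.Properties
  using (+-0-commutativeMonoid; +-commutativeSemigroup; +-mono-≤; +-monoʳ-≤; +-monoˡ-≤; +-identityʳ;
         +-assoc; +-cancelʳ-≤; ≤-refl; ≤-reflexive; ≤-trans; ≤-antisym; <-irrefl; ≤ᵇ⇒≤;
         *-cancelˡ-≤; *-identityʳ; *-zeroʳ; *-distribˡ-+; *-monoʳ-≤; module ≤-Reasoning)
open import Algebra.Properties.CommutativeSemigroup +-commutativeSemigroup using (interchange)
open import Algebra.Properties.CommutativeMonoid.Sum +-0-commutativeMonoid
  using (sum; sum-syntax; ∑-comm; ∑-distrib-+; sum-cong-≗; sum-remove; sum-replicate-zero)
import Data.Nat.ListAction as List
open import Data.Fin using (Fin; zero; suc; punchIn)
open import Data.Fin.Properties using (_≟_; punchInᵢ≢i)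
open import Data.Bool using (Bool; true; false; _∧_; not; _xor_; if_then_else_)
open import Data.Bool.Properties using (if-eta; if-swap-else; ∧-comm; ∧-inverseʳ)
open import Data.List using (tabulate)
open import Data.List.Properties using (map-tabulate)
open import Data.Product using (_×_; _,_; proj₁; proj₂)
open import Data.Sum using (_⊎_; inj₁; inj₂) renaming (map to map-⊎)
open import Data.Empty using (⊥; ⊥-elim)
open import Function using (id; _∘_)
open import Function.Bundles using (_⇔_; mk⇔)
open import Relation.Binary.PropositionalEquality
open import Relation.Nullary using (¬_; does; yes; no)
open import Relation.Nullary.Decidable using (dec-true; dec-false)

private variable
  n : ℕ

Σv≡∑ : (f : Fin n → ℕ) → Σv f ≡ ∑[ i < n ] f i
Σv≡∑ {n} f = trans (cong List.sum (map-tabulate id f)) (sum-tabulate f)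
  where
  sum-tabulate : ∀ {n} (f : Fin n → ℕ) → List.sum (tabulate f) ≡ sum f
  sum-tabulate {zero}  f = refl
  sum-tabulate {suc n} f = cong (f zero +_) (sum-tabulate (f ∘ suc))

∑-mono-≤ : {f g : Fin n → ℕ} → (∀ i → f i ≤ g i) → sum f ≤ sum g
∑-mono-≤ {zero}  f≤g = z≤n
∑-mono-≤ {suc n} f≤g = +-mono-≤ (f≤g zero) (∑-mono-≤ (f≤g ∘ suc))

∑-eq-single : (f : Fin n → ℕ) (a : Fin n) → (∀ i → i ≢ a → f i ≡ 0) → sum f ≡ f a
∑-eq-single {suc n} f a f≡0 = begin
  sum f                      ≡⟨ sum-remove {i = a} f ⟩
  f a + sum (f ∘ punchIn a)  ≡⟨ cong (f a +_) (sum-cong-≗ (λ i → f≡0 _ (punchInᵢ≢i a i))) ⟩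
  f a + sum {n} (λ _ → 0)    ≡⟨ cong (f a +_) (sum-replicate-zero n) ⟩
  f a + 0                    ≡⟨ +-identityʳ (f a) ⟩
  f a                        ∎
  where open ≡-Reasoning

∑∑-distrib-+ : (f g : Fin n → Fin n → ℕ) →
  ∑[ i < n ] ∑[ j < n ] (f i j + g i j) ≡ ∑[ i < n ] ∑[ j < n ] f i j + ∑[ i < n ] ∑[ j < n ] g i j
∑∑-distrib-+ {n} f g = trans (sum-cong-≗ (λ i → ∑-distrib-+ (f i) (g i))) (∑-distrib-+ {n} _ _)

m+m≤n+n⇒m≤n : ∀ {m n} → m + m ≤ n + n → m ≤ n
m+m≤n+n⇒m≤n {m} {n} le =
  *-cancelˡ-≤ 2 (subst₂ (λ x y → m + x ≤ n + y) (sym (+-identityʳ m)) (sym (+-identityʳ n)) le)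

if-else-0-+ : ∀ b {x y : ℕ} →
  (if b then x + y else 0) ≡ (if b then x else 0) + (if b then y else 0)
if-else-0-+ true  = refl
if-else-0-+ false = refl

if-else-0-≤ : ∀ b {x} → (if b then x else 0) ≤ x
if-else-0-≤ true  = ≤-refl
if-else-0-≤ false = z≤n

if-∧-not-+≡if-xor : ∀ p q {x : ℕ} →
  (if p ∧ not q then x else 0) + (if q ∧ not p then x else 0) ≡ (if p xor q then x else 0)
if-∧-not-+≡if-xor true  true  = refl
if-∧-not-+≡if-xor true  false = +-identityʳ _
if-∧-not-+≡if-xor false true  = refl
if-∧-not-+≡if-xor false false = refl

indicator : Bool → ℕ
indicator true  = 1
indicator false = 0

if-else-0≡*indicator : ∀ b x → (if b then x else 0) ≡ x * indicator b
if-else-0≡*indicator true  x = sym (*-identityʳ x)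
if-else-0≡*indicator false x = sym (*-zeroʳ x)

if-else-0-mono : ∀ p q r s x → indicator p + indicator q ≤ indicator r + indicator s →
  (if p then x else 0) + (if q then x else 0) ≤ (if r then x else 0) + (if s then x else 0)
if-else-0-mono p q r s x le rewrite if-else-0≡*indicator p x | if-else-0≡*indicator q x
  | if-else-0≡*indicator r x | if-else-0≡*indicator s x
  | sym (*-distribˡ-+ x (indicator p) (indicator q)) | sym (*-distribˡ-+ x (indicator r) (indicator s))
  = *-monoʳ-≤ x le

xor≡true⇒≡not : ∀ x y → x xor y ≡ true → y ≡ not x
xor≡true⇒≡not true  false _ = refl
xor≡true⇒≡not false true  _ = refl

pigeonhole-Bool : ∀ (p q r : Bool) → p ≡ q ⊎ p ≡ r ⊎ q ≡ r
pigeonhole-Bool true  true  _     = inj₁ refl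
pigeonhole-Bool false false _     = inj₁ refl
pigeonhole-Bool true  false true  = inj₂ (inj₁ refl)
pigeonhole-Bool true  false false = inj₂ (inj₂ refl)
pigeonhole-Bool false true  true  = inj₂ (inj₂ refl)
pigeonhole-Bool false true  false = inj₂ (inj₁ refl)

crossing : Weights n → VSet n → Fin n → Fin n → ℕ
crossing w X i j = if X i ∧ not (X j) then w i j else 0

d≡∑∑crossing : (w : Weights n) (X : VSet n) → d w X ≡ ∑[ i < n ] ∑[ j < n ] crossing w X i j
d≡∑∑crossing {n} w X = trans (Σv≡∑ {n} _) (sum-cong-≗ (λ i → Σv≡∑ (crossing w X i)))

d-+ : {w w₁ w₂ : Weights n} → (∀ i j → w i j ≡ w₁ i j + w₂ i j) →
  ∀ X → d w X ≡ d w₁ X + d w₂ X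
d-+ {n} {w} {w₁} {w₂} w≡w₁+w₂ X = begin
  d w X
    ≡⟨ d≡∑∑crossing w X ⟩
  ∑[ i < n ] ∑[ j < n ] crossing w X i j
    ≡⟨ sum-cong-≗ (λ i → sum-cong-≗ (λ j →
         trans (cong (if X i ∧ not (X j) then_else 0) (w≡w₁+w₂ i j)) (if-else-0-+ (X i ∧ not (X j))))) ⟩
  ∑[ i < n ] ∑[ j < n ] (crossing w₁ X i j + crossing w₂ X i j)
    ≡⟨ ∑∑-distrib-+ (crossing w₁ X) (crossing w₂ X) ⟩
  ∑[ i < n ] ∑[ j < n ] crossing w₁ X i j + ∑[ i < n ] ∑[ j < n ] crossing w₂ X i j
    ≡⟨ sym (cong₂ _+_ (d≡∑∑crossing w₁ X) (d≡∑∑crossing w₂ X)) ⟩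
  d w₁ X + d w₂ X ∎
  where open ≡-Reasoning

arc : Fin n → Fin n → ℕ → Weights n
arc a b c i j = if does (i ≟ a) ∧ does (j ≟ b) then c else 0

d-arc : ∀ (a b : Fin n) c X → d (arc a b c) X ≡ (if X a ∧ not (X b) then c else 0)
d-arc {n} a b c X = begin
  d (arc a b c) X
    ≡⟨ d≡∑∑crossing (arc a b c) X ⟩
  ∑[ i < n ] ∑[ j < n ] crossing (arc a b c) X i j
    ≡⟨ ∑-eq-single _ a (λ i i≢a → trans (sum-cong-≗ (λ j → off-row i i≢a j)) (sum-replicate-zero n)) ⟩
  ∑[ j < n ] crossing (arc a b c) X a j
    ≡⟨ ∑-eq-single _ b off-column ⟩
  crossing (arc a b c) X a b
    ≡⟨ on-arc ⟩
  (if X a ∧ not (X b) then c else 0) ∎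
  where
  open ≡-Reasoning
  off-row : ∀ i → i ≢ a → ∀ j → crossing (arc a b c) X i j ≡ 0
  off-row i i≢a j rewrite dec-false (i ≟ a) i≢a = if-eta (X i ∧ not (X j))
  off-column : ∀ j → j ≢ b → crossing (arc a b c) X a j ≡ 0
  off-column j j≢b rewrite dec-true (a ≟ a) refl | dec-false (j ≟ b) j≢b = if-eta (X a ∧ not (X j))
  on-arc : crossing (arc a b c) X a b ≡ (if X a ∧ not (X b) then c else 0)
  on-arc rewrite dec-true (a ≟ a) refl | dec-true (b ≟ b) refl = refl

deleteArc : Weights n → Fin n → Fin n → Weights n
deleteArc w a b i j = if does (i ≟ a) ∧ does (j ≟ b) then 0 else w i j

deleteArc-+-arc : ∀ (w : Weights n) a b i j → w i j ≡ deleteArc w a b i j + arc a b (w a b) i j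
deleteArc-+-arc w a b i j with i ≟ a | j ≟ b
... | yes refl | yes refl = refl
... | yes _    | no _     = sym (+-identityʳ (w i j))
... | no _     | _        = sym (+-identityʳ (w i j))

d-deleteArc : ∀ (w : Weights n) a b X →
  d w X ≡ d (deleteArc w a b) X + (if X a ∧ not (X b) then w a b else 0)
d-deleteArc w a b X =
  trans (d-+ (deleteArc-+-arc w a b) X) (cong (d (deleteArc w a b) X +_) (d-arc a b (w a b) X))

Symmetric : Weights n → Set
Symmetric w = ∀ i j → w i j ≡ w j i

deleteEdge-sym : {w : Weights n} → Symmetric w → ∀ u v → Symmetric (deleteEdge w u v)
deleteEdge-sym {w = w} sym-w u v i j
  rewrite ∧-comm (does (j ≟ u)) (does (i ≟ v)) | ∧-comm (does (j ≟ v)) (does (i ≟ u)) | sym-w j i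
  = if-swap-else (does (i ≟ u) ∧ does (j ≟ v)) (does (i ≟ v) ∧ does (j ≟ u))

-- Posimodularity fails term by term over ordered pairs; pairing (i, j) with (j, i) repairs this.
d+d≡∑∑xor : {w : Weights n} → Symmetric w → ∀ X →
  d w X + d w X ≡ ∑[ i < n ] ∑[ j < n ] (if X i xor X j then w i j else 0)
d+d≡∑∑xor {n} {w} sym-w X = begin
  d w X + d w X
    ≡⟨ cong₂ _+_ (d≡∑∑crossing w X) (trans (d≡∑∑crossing w X) (∑-comm (crossing w X))) ⟩
  ∑[ i < n ] ∑[ j < n ] crossing w X i j + ∑[ i < n ] ∑[ j < n ] crossing w X j i
    ≡⟨ sym (∑∑-distrib-+ (crossing w X) (λ i j → crossing w X j i)) ⟩
  ∑[ i < n ] ∑[ j < n ] (crossing w X i j + crossing w X j i)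
    ≡⟨ sum-cong-≗ (λ i → sum-cong-≗ (λ j →
         trans (cong (λ x → crossing w X i j + (if X j ∧ not (X i) then x else 0)) (sym (sym-w i j)))
               (if-∧-not-+≡if-xor (X i) (X j)))) ⟩
  ∑[ i < n ] ∑[ j < n ] (if X i xor X j then w i j else 0) ∎
  where open ≡-Reasoning

_─_ : VSet n → VSet n → VSet n
(A ─ B) i = A i ∧ not (B i)

posimodular-indicator : ∀ ai aj bi bj →
  indicator ((ai ∧ not bi) xor (aj ∧ not bj)) + indicator ((bi ∧ not ai) xor (bj ∧ not aj))
    ≤ indicator (ai xor aj) + indicator (bi xor bj)
posimodular-indicator true  true  true  true  = ≤ᵇ⇒≤ _ _ _
posimodular-indicator true  true  true  false = ≤ᵇ⇒≤ _ _ _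
posimodular-indicator true  true  false true  = ≤ᵇ⇒≤ _ _ _
posimodular-indicator true  true  false false = ≤ᵇ⇒≤ _ _ _
posimodular-indicator true  false true  true  = ≤ᵇ⇒≤ _ _ _
posimodular-indicator true  false true  false = ≤ᵇ⇒≤ _ _ _
posimodular-indicator true  false false true  = ≤ᵇ⇒≤ _ _ _
posimodular-indicator true  false false false = ≤ᵇ⇒≤ _ _ _
posimodular-indicator false true  true  true  = ≤ᵇ⇒≤ _ _ _
posimodular-indicator false true  true  false = ≤ᵇ⇒≤ _ _ _
posimodular-indicator false true  false true  = ≤ᵇ⇒≤ _ _ _
posimodular-indicator false true  false false = ≤ᵇ⇒≤ _ _ _
posimodular-indicator false false true  true  = ≤ᵇ⇒≤ _ _ _
posimodular-indicator false false true  false = ≤ᵇ⇒≤ _ _ _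
posimodular-indicator false false false true  = ≤ᵇ⇒≤ _ _ _
posimodular-indicator false false false false = ≤ᵇ⇒≤ _ _ _

posimodular-pair : ∀ ai aj bi bj x →
  (if (ai ∧ not bi) xor (aj ∧ not bj) then x else 0) + (if (bi ∧ not ai) xor (bj ∧ not aj) then x else 0)
    ≤ (if ai xor aj then x else 0) + (if bi xor bj then x else 0)
posimodular-pair ai aj bi bj x = if-else-0-mono
  ((ai ∧ not bi) xor (aj ∧ not bj)) ((bi ∧ not ai) xor (bj ∧ not aj)) (ai xor aj) (bi xor bj) x
  (posimodular-indicator ai aj bi bj)

d-posimodular : {w : Weights n} → Symmetric w → ∀ A B →
  d w (A ─ B) + d w (B ─ A) ≤ d w A + d w B
d-posimodular {n} {w} sym-w A B = m+m≤n+n⇒m≤n (begin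
  (d w (A ─ B) + d w (B ─ A)) + (d w (A ─ B) + d w (B ─ A))
    ≡⟨ interchange (d w (A ─ B)) _ _ _ ⟩
  (d w (A ─ B) + d w (A ─ B)) + (d w (B ─ A) + d w (B ─ A))
    ≡⟨ cong₂ _+_ (d+d≡∑∑xor sym-w (A ─ B)) (d+d≡∑∑xor sym-w (B ─ A)) ⟩
  ∑∑xor (A ─ B) + ∑∑xor (B ─ A)
    ≡⟨ sym (∑∑-distrib-+ (xor-term (A ─ B)) (xor-term (B ─ A))) ⟩
  ∑[ i < n ] ∑[ j < n ] (xor-term (A ─ B) i j + xor-term (B ─ A) i j)
    ≤⟨ ∑-mono-≤ (λ i → ∑-mono-≤ (λ j →
         posimodular-pair (A i) (A j) (B i) (B j) (w i j))) ⟩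
  ∑[ i < n ] ∑[ j < n ] (xor-term A i j + xor-term B i j)
    ≡⟨ ∑∑-distrib-+ (xor-term A) (xor-term B) ⟩
  ∑∑xor A + ∑∑xor B
    ≡⟨ sym (cong₂ _+_ (d+d≡∑∑xor sym-w A) (d+d≡∑∑xor sym-w B)) ⟩
  (d w A + d w A) + (d w B + d w B)
    ≡⟨ interchange (d w A) _ _ _ ⟩
  (d w A + d w B) + (d w A + d w B) ∎)
  where
  open ≤-Reasoning
  xor-term : VSet n → Fin n → Fin n → ℕ
  xor-term X i j = if X i xor X j then w i j else 0
  ∑∑xor : VSet n → ℕ
  ∑∑xor X = ∑[ i < n ] ∑[ j < n ] xor-term X i j

Separates : VSet n → Fin n → Fin n → Set
Separates X u v = X u xor X v ≡ true

separates⇒∈ : ∀ (X : VSet n) {u v} → Separates X u v → X u ≡ true ⊎ X v ≡ true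
separates⇒∈ X {u} sep with X u
... | true  = inj₁ refl
... | false = inj₂ sep

separates-agree : ∀ {A B : VSet n} {u v} → Separates A u v → Separates B u v → A u ≡ B u → A v ≡ B v
separates-agree {A = A} {B} {u} {v} sepA sepB Au≡Bu = begin
  A v       ≡⟨ xor≡true⇒≡not (A u) (A v) sepA ⟩
  not (A u) ≡⟨ cong not Au≡Bu ⟩
  not (B u) ≡⟨ xor≡true⇒≡not (B u) (B v) sepB ⟨
  B v       ∎
  where open ≡-Reasoning

─-nonseparating : ∀ {A B : VSet n} {u v} → A u ≡ B u → A v ≡ B v → ¬ Separates (A ─ B) u v
─-nonseparating {A = A} {B} {u} {v} Au≡Bu Av≡Bv sep = false≢true (begin
  false                                    ≡⟨⟩
  false xor false                          ≡⟨ cong₂ _xor_ (excluded u Au≡Bu) (excluded v Av≡Bv) ⟨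
  (A u ∧ not (B u)) xor (A v ∧ not (B v))  ≡⟨ sep ⟩
  true                                     ∎)
  where
  open ≡-Reasoning
  excluded : ∀ i → A i ≡ B i → (A ─ B) i ≡ false
  excluded i Ai≡Bi = trans (cong (_∧ not (B i)) Ai≡Bi) (∧-inverseʳ (B i))
  false≢true : false ≢ true
  false≢true ()

∈⟦⟧⇒≡ : ∀ {t i : Fin n} → ⟦ t ⟧ i ≡ true → i ≡ t
∈⟦⟧⇒≡ {t = t} {i} i∈⟦t⟧ with i ≟ t
... | yes i≡t = i≡t
∈⟦⟧⇒≡ () | no _

endpoint-separates : ∀ {u v t : Fin n} → u ≢ v → t ≡ u ⊎ t ≡ v → Separates ⟦ t ⟧ u v
endpoint-separates {u = u} {v} u≢v (inj₁ refl)
  rewrite dec-true (u ≟ u) refl | dec-false (v ≟ u) (u≢v ∘ sym) = refl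
endpoint-separates {u = u} {v} u≢v (inj₂ refl)
  rewrite dec-true (v ≟ v) refl | dec-false (u ≟ v) u≢v = refl

─-isIsolatingCut : ∀ {T : VSet n} {a b} {A B : VSet n} → a ≢ b → T a ≡ true →
  IsCut ⟦ a ⟧ (T ∖ a) A → IsCut ⟦ b ⟧ (T ∖ b) B → IsCut ⟦ a ⟧ (T ∖ a) (A ─ B)
─-isIsolatingCut {T = T} {a} {b} {A} {B} a≢b Ta (⟦a⟧⊆A , A∩T∖a≡∅) (_ , B∩T∖b≡∅) =
  ⟦a⟧⊆A─B , A─B∩T∖a≡∅
  where
  a∈T∖b : (T ∖ b) a ≡ true
  a∈T∖b rewrite Ta | dec-false (a ≟ b) a≢b = refl
  ⟦a⟧⊆A─B : ⟦ a ⟧ ⊆ (A ─ B)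
  ⟦a⟧⊆A─B i i∈⟦a⟧ with refl ← ∈⟦⟧⇒≡ {t = a} {i} i∈⟦a⟧
    rewrite ⟦a⟧⊆A i i∈⟦a⟧ | B∩T∖b≡∅ i a∈T∖b = refl
  A─B∩T∖a≡∅ : ∀ i → (T ∖ a) i ≡ true → (A ─ B) i ≡ false
  A─B∩T∖a≡∅ i i∈T∖a rewrite A∩T∖a≡∅ i i∈T∖a = refl

─-isMinIsoCut : ∀ {w : Weights n} {T : VSet n} {a b} {A B : VSet n} → Symmetric w → a ≢ b →
  T a ≡ true → T b ≡ true → IsMinIsoCut w T a A → IsMinIsoCut w T b B → IsMinIsoCut w T a (A ─ B)
─-isMinIsoCut {w = w} {T} {a} {b} {A} {B} sym-w a≢b Ta Tb (cutA , minA) (cutB , minB) =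
  cutA─B , λ Z cutZ → ≤-trans dA─B≤dA (minA Z cutZ)
  where
  cutA─B : IsCut ⟦ a ⟧ (T ∖ a) (A ─ B)
  cutA─B = ─-isIsolatingCut a≢b Ta cutA cutB
  cutB─A : IsCut ⟦ b ⟧ (T ∖ b) (B ─ A)
  cutB─A = ─-isIsolatingCut (a≢b ∘ sym) Tb cutB cutA
  dA─B≤dA : d w (A ─ B) ≤ d w A
  dA─B≤dA = +-cancelʳ-≤ (d w (B ─ A)) (d w (A ─ B)) (d w A) (begin
    d w (A ─ B) + d w (B ─ A) ≤⟨ d-posimodular sym-w A B ⟩
    d w A + d w B             ≤⟨ +-monoʳ-≤ (d w A) (minB (B ─ A) cutB─A) ⟩
    d w A + d w (B ─ A)       ∎)
    where open ≤-Reasoning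

module EdgeDeletion {n} {w : Weights n} (sym-w : Symmetric w) (T : VSet n) {u v : Fin n} (u≢v : u ≢ v) where

  w∖e : Weights n
  w∖e = deleteEdge w u v

  -- deleteEdge w u v is definitionally deleteArc (deleteArc w v u) u v.
  d-deleteEdge : ∀ X → d w X ≡ d w∖e X + (if X u xor X v then w u v else 0)
  d-deleteEdge X = begin
    d w X
      ≡⟨ d-deleteArc w v u X ⟩
    d (deleteArc w v u) X + (if X v ∧ not (X u) then w v u else 0)
      ≡⟨ cong (_+ _) (d-deleteArc (deleteArc w v u) u v X) ⟩
    d w∖e X + (if X u ∧ not (X v) then deleteArc w v u u v else 0) + (if X v ∧ not (X u) then w v u else 0)
      ≡⟨ cong₂ (λ x y → d w∖e X + (if X u ∧ not (X v) then x else 0) + (if X v ∧ not (X u) then y else 0))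
           deleteArc-uv (sym-w v u) ⟩
    d w∖e X + (if X u ∧ not (X v) then w u v else 0) + (if X v ∧ not (X u) then w u v else 0)
      ≡⟨ +-assoc (d w∖e X) _ _ ⟩
    d w∖e X + ((if X u ∧ not (X v) then w u v else 0) + (if X v ∧ not (X u) then w u v else 0))
      ≡⟨ cong (d w∖e X +_) (if-∧-not-+≡if-xor (X u) (X v)) ⟩
    d w∖e X + (if X u xor X v then w u v else 0) ∎
    where
    open ≡-Reasoning
    deleteArc-uv : deleteArc w v u u v ≡ w u v
    deleteArc-uv rewrite dec-false (u ≟ v) u≢v = refl

  d-deleteEdge-≤ : ∀ X → d w X ≤ d w∖e X + w u v
  d-deleteEdge-≤ X =
    ≤-trans (≤-reflexive (d-deleteEdge X)) (+-monoʳ-≤ (d w∖e X) (if-else-0-≤ (X u xor X v)))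

  d-deleteEdge-separating : ∀ X → Separates X u v → d w X ≡ d w∖e X + w u v
  d-deleteEdge-separating X sep =
    trans (d-deleteEdge X) (cong (λ b → d w∖e X + (if b then w u v else 0)) sep)

  d-deleteEdge-<⇒separates : ∀ X → d w∖e X < d w X → Separates X u v
  d-deleteEdge-<⇒separates X lt with X u xor X v | d-deleteEdge X
  ... | true  | _  = refl
  ... | false | eq = ⊥-elim (<-irrefl (sym (trans eq (+-identityʳ (d w∖e X)))) lt)

  module _ {t : Fin n} {X Y : VSet n} (minX : IsMinIsoCut w∖e T t X) (minY : IsMinIsoCut w T t Y) where

    decrease⇒minIsoCuts-separate : d w∖e X < d w Y → ∀ Z → IsMinIsoCut w∖e T t Z → Separates Z u v
    decrease⇒minIsoCuts-separate lt Z (cutZ , minZ) = d-deleteEdge-<⇒separates Z (begin-strict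
      d w∖e Z ≤⟨ minZ X (proj₁ minX) ⟩
      d w∖e X <⟨ lt ⟩
      d w Y   ≤⟨ proj₂ minY Z cutZ ⟩
      d w Z   ∎)
      where open ≤-Reasoning

    decrease-≤ : d w Y ≤ d w∖e X + w u v
    decrease-≤ = ≤-trans (proj₂ minY X (proj₁ minX)) (d-deleteEdge-≤ X)

    decrease-tight⇒endpoint : IsMaxVolMinCut w ⟦ t ⟧ (T ∖ t) ⟦ t ⟧ → d w∖e X < d w Y →
      d w Y ≡ d w∖e X + w u v → t ≡ u ⊎ t ≡ v
    decrease-tight⇒endpoint (_ , maxVol) lt tight =
      map-⊎ (λ Xu → sym (∈⟦⟧⇒≡ (X⊆⟦t⟧ u Xu))) (λ Xv → sym (∈⟦⟧⇒≡ (X⊆⟦t⟧ v Xv)))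
            (separates⇒∈ X (decrease⇒minIsoCuts-separate lt X minX))
      where
      X⊆⟦t⟧ : X ⊆ ⟦ t ⟧
      X⊆⟦t⟧ = maxVol X (proj₁ minX , λ Z cutZ →
        ≤-trans (d-deleteEdge-≤ X) (≤-trans (≤-reflexive (sym tight)) (proj₂ minY Z cutZ)))

    endpoint⇒decrease-tight : IsMinCut w ⟦ t ⟧ (T ∖ t) ⟦ t ⟧ → t ≡ u ⊎ t ≡ v → d w Y ≡ d w∖e X + w u v
    endpoint⇒decrease-tight (cut⟦t⟧ , min⟦t⟧) endpoint = ≤-antisym decrease-≤ (begin
      d w∖e X + w u v     ≤⟨ +-monoˡ-≤ (w u v) (proj₂ minX ⟦ t ⟧ cut⟦t⟧) ⟩
      d w∖e ⟦ t ⟧ + w u v ≡⟨ d-deleteEdge-separating ⟦ t ⟧ (endpoint-separates u≢v endpoint) ⟨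
      d w ⟦ t ⟧           ≤⟨ min⟦t⟧ Y (proj₁ minY) ⟩
      d w Y               ∎)
      where open ≤-Reasoning

  isolating-cut-decrease : (∀ t → T t ≡ true → IsMaxVolMinCut w ⟦ t ⟧ (T ∖ t) ⟦ t ⟧) →
    ∀ t → T t ≡ true → ∀ X Y → IsMinIsoCut w∖e T t X → IsMinIsoCut w T t Y → d w∖e X < d w Y →
      (∀ Z → IsMinIsoCut w∖e T t Z → Z u ≡ true ⊎ Z v ≡ true)
    × (d w Y ≤ d w∖e X + w u v)
    × ((d w Y ≡ d w∖e X + w u v) ⇔ (t ≡ u ⊎ t ≡ v))
  isolating-cut-decrease singletonsMaxVol t Tt X Y minX minY lt =
      (λ Z minZ → separates⇒∈ Z (decrease⇒minIsoCuts-separate minX minY lt Z minZ))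
    , decrease-≤ minX minY
    , mk⇔ (decrease-tight⇒endpoint minX minY (singletonsMaxVol t Tt) lt)
          (endpoint⇒decrease-tight minX minY (proj₁ (singletonsMaxVol t Tt)))

  decreasing-minIsoCuts-disagree : ∀ {a b} {A B : VSet n} → a ≢ b → T a ≡ true → T b ≡ true →
    Decreases w w∖e T a → Decreases w w∖e T b →
    IsMinIsoCut w∖e T a A → IsMinIsoCut w∖e T b B → A u ≢ B u
  decreasing-minIsoCuts-disagree {A = A} {B} a≢b Ta Tb
    (Xa , _ , minXa , minYa , lta) (Xb , _ , minXb , minYb , ltb) minA minB Au≡Bu =
    ─-nonseparating {A = A} {B} Au≡Bu (separates-agree {A = A} {B} sepA sepB Au≡Bu)
      (decrease⇒minIsoCuts-separate minXa minYa lta (A ─ B)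
        (─-isMinIsoCut (deleteEdge-sym sym-w u v) a≢b Ta Tb minA minB))
    where
    sepA : Separates A u v
    sepA = decrease⇒minIsoCuts-separate minXa minYa lta A minA
    sepB : Separates B u v
    sepB = decrease⇒minIsoCuts-separate minXb minYb ltb B minB

  at-most-two-decrease : ∀ (a b c : Fin n) → T a ≡ true → T b ≡ true → T c ≡ true →
    ¬ a ≡ b → ¬ a ≡ c → ¬ b ≡ c →
    Decreases w w∖e T a → Decreases w w∖e T b → Decreases w w∖e T c → ⊥
  at-most-two-decrease a b c Ta Tb Tc a≢b a≢c b≢c
    Da@(A , _ , minA , _) Db@(B , _ , minB , _) Dc@(C , _ , minC , _)
    with pigeonhole-Bool (A u) (B u) (C u)
  ... | inj₁ Au≡Bu        = decreasing-minIsoCuts-disagree a≢b Ta Tb Da Db minA minB Au≡Bu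
  ... | inj₂ (inj₁ Au≡Cu) = decreasing-minIsoCuts-disagree a≢c Ta Tc Da Dc minA minC Au≡Cu
  ... | inj₂ (inj₂ Bu≡Cu) = decreasing-minIsoCuts-disagree b≢c Tb Tc Db Dc minB minC Bu≡Cu

lemma1 : ∀ {n : ℕ} (w : Weights n) → IsSimpleGraph w
    → (T : VSet n)
    → (∀ t → T t ≡ true → IsMaxVolMinCut w ⟦ t ⟧ (T ∖ t) ⟦ t ⟧)
    → (u v : Fin n) → 0 < w u v
    → (∀ (t : Fin n) → T t ≡ true → ∀ (X Y : VSet n)
         → IsMinIsoCut (deleteEdge w u v) T t X
         → IsMinIsoCut w T t Y
         → d (deleteEdge w u v) X < d w Y
         → (∀ (Z : VSet n) → IsMinIsoCut (deleteEdge w u v) T t Z → (Z u ≡ true ⊎ Z v ≡ true))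
           × (d w Y ≤ d (deleteEdge w u v) X + w u v)
           × ((d w Y ≡ d (deleteEdge w u v) X + w u v) ⇔ (t ≡ u ⊎ t ≡ v)))
      × (∀ (a b c : Fin n) → T a ≡ true → T b ≡ true → T c ≡ true
         → ¬ a ≡ b → ¬ a ≡ c → ¬ b ≡ c
         → Decreases w (deleteEdge w u v) T a
         → Decreases w (deleteEdge w u v) T b
         → Decreases w (deleteEdge w u v) T c → ⊥)
lemma1 w (sym-w , loopless) T singletonsMaxVol u v 0<wuv =
  isolating-cut-decrease singletonsMaxVol , at-most-two-decrease
  where
  u≢v : u ≢ v
  u≢v refl = <-irrefl (sym (loopless u)) 0<wuv
  open EdgeDeletion sym-w T u≢v
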